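{- Let $M$ be a program. If $c=[\![(\exists)\,\mathcal{A}\mid\{b;t\}]\!]$ is a configuration of the computation of $\mathcal{K}_{\mathcal{B}}$ on $M$, then $\mathcal{K}_{\mathcal{B}}$ accepts $c$ if and only if $b\leftarrow(t)^{\mathcal{A}}$; if $c=[\![(\forall)\,\mathcal{A}\mid\{b;t\}\{b';t'\}]\!]$ is such a configuration, then $\mathcal{K}_{\mathcal{B}}$ accepts $c$ if and only if $b\leftarrow(t)^{\mathcal{A}}$ and $b'\leftarrow(t')^{\mathcal{A}}$.
   Context: $\Lambda_B$ terms: $t,u,v::=x\mid F\mid T\mid \lambda x.t\mid t\,u\mid \mathrm{if}\ t\ \mathrm{then}\ u\ \mathrm{else}\ v$, with $\beta$-reduction and $\delta$-reduction (contextual closure of $(\mathrm{if}\ T\ \mathrm{then}\ u\ \mathrm{else}\ v)\to u$, $(\mathrm{if}\ F\ \mathrm{then}\ u\ \mathrm{else}\ v)\to v$). Types of $\mathbf{DLAL_B}$: $A,B::=\alpha\mid A\multimap B\mid A\Rightarrow B\mid \S A\mid \forall\alpha.A\mid \mathbf{Bool}$, judgements $\Gamma;\Delta\vdash t:A$ ($\Gamma$ non-linear, $\Delta$ linear variable declarations, disjoint). Rules: (Id) $;x:A\vdash x:A$. ($\multimap$i) from $\Gamma;\Delta,x:A\vdash t:B$ infer $\Gamma;\Delta\vdash\lambda x.t:A\multimap B$. ($\multimap$e) from $\Gamma_1;\Delta_1\vdash t:A\multimap B$ and $\Gamma_2;\Delta_2\vdash u:A$ infer $\Gamma_1,\Gamma_2;\Delta_1,\Delta_2\vdash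 t\,u:B$. ($\Rightarrow$i) from $\Gamma,x:A;\Delta\vdash t:B$ infer $\Gamma;\Delta\vdash \lambda x.t:A\Rightarrow B$. ($\Rightarrow$e) from $\Gamma;\Delta\vdash t:A\Rightarrow B$ and $;z:C\vdash u:A$ infer $\Gamma,z:C;\Delta\vdash t\,u:B$ (right premise may also be $;\vdash u:A$, conclusion $\Gamma;\Delta\vdash t\,u:B$). (Weak) from $\Gamma_1;\Delta_1\vdash t:A$ infer $\Gamma_1,\Gamma_2;\Delta_1,\Delta_2\vdash t:A$. (Cntr) from $x_1:A,x_2:A,\Gamma;\Delta\vdash t:B$ infer $x:A,\Gamma;\Delta\vdash t[x/x_1,x/x_2]:B$. ($\S$i) from $;\Gamma,\Delta\vdash t:A$ infer $\Gamma;\S\Delta\vdash t:\S A$. ($\S$e) from $\Gamma_1;\Delta_1\vdash u:\S A$ and $\Gamma_2;x:\S A,\Delta_2\vdash t:B$ infer $\Gamma_1,\Gamma_2;\Delta_1,\Delta_2\vdash t[u/x]:B$. ($\forall$i) from $\Gamma;\Delta\vdash t:A$ infer $\Gamma;\Delta\vdash t:\forall\alpha.A$ if $\alpha$ not free in $\Gamma,\Delta$. ($\forall$e) from $\Gamma;\Delta\vdash t:\forall\alpha.A$ infer $\Gamma;\Delta\vdash t:A[B/\alpha]$. ($B_0$i) $;\vdash F:\mathbf{Bool}$; ($B_1$i) $;\vdash T:\mathbf{Bool}$. ($B$e) from $\Gamma;\Delta\vdash M_0:\S^k\mathbf{Bool}$, $\Gamma;\Delta\vdash M_1:A$, $\Gamma;\Delta\vdash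 M_2:A$ infer $\Gamma;\Delta\vdash \mathrm{if}\ M_0\ \mathrm{then}\ M_1\ \mathrm{else}\ M_2:A$. A program is a term $M$ with $;\vdash M:\S^n\mathbf{Bool}$ for some $n$. For a term $s$ with a unique $\beta\delta$-normal form $Norm(s)$: $no\leftarrow s$ iff $Norm(s)=F$, and $yes\leftarrow s$ iff $Norm(s)=T$. Machine $\mathcal{K}_{\mathcal{B}}$. A context $\mathcal{A}=[x_1:=t_1,\dots,x_n:=t_n]$ is a sequence of assignments with distinct $x_i$; $(t)^{\mathcal{A}}=t[t_n/x_n]\cdots[t_1/x_1]$; $\emptyset$ is the empty context, $@$ concatenation. Configurations: $[\![\mathrm{Rejecting}]\!]$, $[\![\mathrm{Accepting}]\!]$, $[\![(\exists)\,\mathcal{A}\mid\{b;t\}]\!]$, $[\![(\forall)\,\mathcal{A}\mid\{b;t\}\{b';t'\}]\!]$, $b,b'\in\{yes,no\}$. Transitions: ($\beta$) $[\![(\exists)\mathcal{A}\mid\{b;(\lambda x.N)N_1\cdots N_p\}]\!]\to[\![(\exists)\mathcal{A}@(x':=N_1)\mid\{b;N[x'/x]N_2\cdots N_p\}]\!]$, $x'$ fresh; ($h$) $[\![(\exists)\mathcal{A}_1@(x:=N)@\mathcal{A}_2\mid\{b;x N_1\cdots N_p\}]\!]\to[\![(\exists)\mathcal{A}_1@(x:=N)@\mathcal{A}_2\mid\{b;N N_1\cdots N_p\}]\!]$; ($if$) $[\![(\exists)\mathcal{A}\mid\{b;(\mathrm{if}\ M_0\ \mathrm{then}\ M_1\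 \mathrm{else}\ M_2)N_1\cdots N_p\}]\!]$ has successors $[\![(\forall)\mathcal{A}\mid\{yes;M_0\}\{b;M_1N_1\cdots N_p\}]\!]$ and $[\![(\forall)\mathcal{A}\mid\{no;M_0\}\{b;M_2N_1\cdots N_p\}]\!]$; ($if'$) $[\![(\forall)\mathcal{A}\mid\{a;M_0\}\{b;N\}]\!]$ has successors $[\![(\exists)\mathcal{A}\mid\{a;M_0\}]\!]$ and $[\![(\exists)\mathcal{A}\mid\{b;N\}]\!]$; base cases: $\{yes;T\}$ and $\{no;F\}$ existential configurations go to $[\![\mathrm{Accepting}]\!]$, $\{no;T\}$ and $\{yes;F\}$ ones go to $[\![\mathrm{Rejecting}]\!]$. The computation on $M$ is the tree of configurations reachable from $[\![(\exists)\emptyset\mid\{yes;M\}]\!]$. Acceptance is as for alternating Turing machines: Accepting is accepted, Rejecting is not, an existential configuration is accepted iff some successor is, a universal one iff all successors are. -}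

module Defs where

open import Data.Nat using (ℕ; zero; suc; _+_; _∸_; _≡ᵇ_; _<ᵇ_)
open import Data.Bool using (if_then_else_)
open import Data.List using (List; []; _∷_; _++_; map)
open import Data.Maybe using (Maybe; just; nothing; _>>=_)
import Data.Maybe as Maybe
open import Data.Product using (Σ; _×_; _,_; proj₁; proj₂)
open import Data.Sum using (_⊎_)
open import Relation.Nullary using (¬_)
open import Relation.Binary.PropositionalEquality using (_≡_; _≢_)
open import Relation.Binary.Construct.Closure.ReflexiveTransitive using (Star)
open import Data.List.Relation.Unary.Unique.Propositional using (Unique)
open import Data.List.Relation.Binary.Permutation.Propositional using (_↭_)

-- Λ_B terms, de Bruijn representation (terms up to α-equivalence).
-- Free variable i refers to the i-th enclosing binder / context entry
-- (0 = innermost / most recent).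

data Term : Set where
  var : ℕ → Term
  F   : Term
  T   : Term
  lam : Term → Term
  app : Term → Term → Term
  ite : Term → Term → Term → Term

shift : ℕ → ℕ → Term → Term
shift c d (var i)     = if i <ᵇ c then var i else var (i + d)
shift c d F           = F
shift c d T           = T
shift c d (lam t)     = lam (shift (suc c) d t)
shift c d (app t u)   = app (shift c d t) (shift c d u)
shift c d (ite t u v) = ite (shift c d t) (shift c d u) (shift c d v)

weaken : ℕ → Term → Term
weaken d = shift 0 d

-- substAt k u t : replace index k of t by u (u lives in the scope
-- outside the k binders), decrementing the indices above k
substAt : ℕ → Term → Term → Term
substAt k u (var i)     = if i ≡ᵇ k then weaken k u
                          else (if i <ᵇ k then var i else var (i ∸ 1))
substAt k u F           = F
substAt k u T           = T
substAt k u (lam t)     = lam (substAt (suc k) u t)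
substAt k u (app t v)   = app (substAt k u t) (substAt k u v)
substAt k u (ite t v w) = ite (substAt k u t) (substAt k u v) (substAt k u w)

_[_] : Term → Term → Term
t [ u ] = substAt 0 u t

data _⟶_ : Term → Term → Set where
  β     : ∀ {t u} → app (lam t) u ⟶ (t [ u ])
  δT    : ∀ {u v} → ite T u v ⟶ u
  δF    : ∀ {u v} → ite F u v ⟶ v
  ξlam  : ∀ {t t'} → t ⟶ t' → lam t ⟶ lam t'
  ξappˡ : ∀ {t t' u} → t ⟶ t' → app t u ⟶ app t' u
  ξappʳ : ∀ {t u u'} → u ⟶ u' → app t u ⟶ app t u'
  ξite₀ : ∀ {t t' u v} → t ⟶ t' → ite t u v ⟶ ite t' u v
  ξite₁ : ∀ {t u u' v} → u ⟶ u' → ite t u v ⟶ ite t u' v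
  ξite₂ : ∀ {t u v v'} → v ⟶ v' → ite t u v ⟶ ite t u v'

_⟶*_ : Term → Term → Set
_⟶*_ = Star _⟶_

Normal : Term → Set
Normal t = ∀ u → ¬ (t ⟶ u)

UniqueNF : Term → Term → Set
UniqueNF s n = (s ⟶* n) × Normal n × (∀ n' → s ⟶* n' → Normal n' → n' ≡ n)

data Answer : Set where
  Yes No : Answer

⌜_⌝ : Answer → Term
⌜ Yes ⌝ = T
⌜ No ⌝  = F

_←_ : Answer → Term → Set
b ← s = Σ Term λ n → UniqueNF s n × n ≡ ⌜ b ⌝

data Ty : Set where
  tv     : ℕ → Ty
  _⊸_    : Ty → Ty → Ty
  _⇒_    : Ty → Ty → Ty
  §      : Ty → Ty
  ∀'     : Ty → Ty
  BoolTy : Ty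

tshift : ℕ → ℕ → Ty → Ty
tshift c d (tv i)  = if i <ᵇ c then tv i else tv (i + d)
tshift c d (A ⊸ B) = tshift c d A ⊸ tshift c d B
tshift c d (A ⇒ B) = tshift c d A ⇒ tshift c d B
tshift c d (§ A)   = § (tshift c d A)
tshift c d (∀' A)  = ∀' (tshift (suc c) d A)
tshift c d BoolTy  = BoolTy

tsubstAt : ℕ → Ty → Ty → Ty
tsubstAt k B (tv i)   = if i ≡ᵇ k then tshift 0 k B
                        else (if i <ᵇ k then tv i else tv (i ∸ 1))
tsubstAt k B (A ⊸ A') = tsubstAt k B A ⊸ tsubstAt k B A'
tsubstAt k B (A ⇒ A') = tsubstAt k B A ⇒ tsubstAt k B A'
tsubstAt k B (§ A)    = § (tsubstAt k B A)
tsubstAt k B (∀' A)   = ∀' (tsubstAt (suc k) B A)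
tsubstAt k B BoolTy   = BoolTy

-- A[B/α] for ∀α.A  (α = index 0)
tsubst0 : Ty → Ty → Ty
tsubst0 A B = tsubstAt 0 B A

§^ : ℕ → Ty → Ty
§^ zero    A = A
§^ (suc n) A = § (§^ n A)

-- Named terms (for the typing system, which uses named variables)

data NTerm : Set where
  nvar : ℕ → NTerm
  nF   : NTerm
  nT   : NTerm
  nlam : ℕ → NTerm → NTerm
  napp : NTerm → NTerm → NTerm
  nite : NTerm → NTerm → NTerm → NTerm

data _∈FV_ (x : ℕ) : NTerm → Set where
  fv-var  : x ∈FV nvar x
  fv-lam  : ∀ {y t} → x ≢ y → x ∈FV t → x ∈FV nlam y t
  fv-appˡ : ∀ {t u} → x ∈FV t → x ∈FV napp t u
  fv-appʳ : ∀ {t u} → x ∈FV u → x ∈FV napp t u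
  fv-ite₀ : ∀ {t u v} → x ∈FV t → x ∈FV nite t u v
  fv-ite₁ : ∀ {t u v} → x ∈FV u → x ∈FV nite t u v
  fv-ite₂ : ∀ {t u v} → x ∈FV v → x ∈FV nite t u v

data Subst : NTerm → ℕ → NTerm → NTerm → Set where
  s-var≡ : ∀ {x u} → Subst (nvar x) x u u
  s-var≢ : ∀ {x y u} → x ≢ y → Subst (nvar y) x u (nvar y)
  s-F    : ∀ {x u} → Subst nF x u nF
  s-T    : ∀ {x u} → Subst nT x u nT
  s-lam≡ : ∀ {x t u} → Subst (nlam x t) x u (nlam x t)
  s-lam≢ : ∀ {x y t u r} → x ≢ y → ((¬ (x ∈FV t)) ⊎ (¬ (y ∈FV u))) →
           Subst t x u r → Subst (nlam y t) x u (nlam y r)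
  s-app  : ∀ {x u t₁ t₂ r₁ r₂} → Subst t₁ x u r₁ → Subst t₂ x u r₂ →
           Subst (napp t₁ t₂) x u (napp r₁ r₂)
  s-ite  : ∀ {x u t₁ t₂ t₃ r₁ r₂ r₃} → Subst t₁ x u r₁ → Subst t₂ x u r₂ →
           Subst t₃ x u r₃ → Subst (nite t₁ t₂ t₃) x u (nite r₁ r₂ r₃)

Ctx : Set
Ctx = List (ℕ × Ty)

WF : Ctx → Ctx → Set
WF Γ Δ = Unique (map proj₁ (Γ ++ Δ))

§ctx : Ctx → Ctx
§ctx = map (λ d → proj₁ d , § (proj₂ d))

shiftCtx : Ctx → Ctx
shiftCtx = map (λ d → proj₁ d , tshift 0 1 (proj₂ d))

infix 4 _∣_⊢_∶_
data _∣_⊢_∶_ : Ctx → Ctx → NTerm → Ty → Set where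
  Id   : ∀ {x A} → [] ∣ (x , A) ∷ [] ⊢ nvar x ∶ A
  ⊸i   : ∀ {Γ Δ x A t B} → Γ ∣ Δ ++ (x , A) ∷ [] ⊢ t ∶ B →
         Γ ∣ Δ ⊢ nlam x t ∶ (A ⊸ B)
  ⊸e   : ∀ {Γ₁ Γ₂ Δ₁ Δ₂ t u A B} → WF (Γ₁ ++ Γ₂) (Δ₁ ++ Δ₂) →
         Γ₁ ∣ Δ₁ ⊢ t ∶ (A ⊸ B) → Γ₂ ∣ Δ₂ ⊢ u ∶ A →
         Γ₁ ++ Γ₂ ∣ Δ₁ ++ Δ₂ ⊢ napp t u ∶ B
  ⇒i   : ∀ {Γ Δ x A t B} → Γ ++ (x , A) ∷ [] ∣ Δ ⊢ t ∶ B →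
         Γ ∣ Δ ⊢ nlam x t ∶ (A ⇒ B)
  ⇒e   : ∀ {Γ Δ z C t u A B} → WF (Γ ++ (z , C) ∷ []) Δ →
         Γ ∣ Δ ⊢ t ∶ (A ⇒ B) → [] ∣ (z , C) ∷ [] ⊢ u ∶ A →
         Γ ++ (z , C) ∷ [] ∣ Δ ⊢ napp t u ∶ B
  ⇒e₀  : ∀ {Γ Δ t u A B} →
         Γ ∣ Δ ⊢ t ∶ (A ⇒ B) → [] ∣ [] ⊢ u ∶ A →
         Γ ∣ Δ ⊢ napp t u ∶ B
  Weak : ∀ {Γ₁ Γ₂ Δ₁ Δ₂ t A} → WF (Γ₁ ++ Γ₂) (Δ₁ ++ Δ₂) →
         Γ₁ ∣ Δ₁ ⊢ t ∶ A → Γ₁ ++ Γ₂ ∣ Δ₁ ++ Δ₂ ⊢ t ∶ A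
  Cntr : ∀ {x x₁ x₂ A Γ Δ t t₁ t₂ B} → WF ((x , A) ∷ Γ) Δ →
         Subst t x₁ (nvar x) t₁ → Subst t₁ x₂ (nvar x) t₂ →
         (x₁ , A) ∷ (x₂ , A) ∷ Γ ∣ Δ ⊢ t ∶ B →
         (x , A) ∷ Γ ∣ Δ ⊢ t₂ ∶ B
  §i   : ∀ {Γ Δ t A} → [] ∣ Γ ++ Δ ⊢ t ∶ A → Γ ∣ §ctx Δ ⊢ t ∶ § A
  §e   : ∀ {Γ₁ Γ₂ Δ₁ Δ₂ x t u r A B} → WF (Γ₁ ++ Γ₂) (Δ₁ ++ Δ₂) →
         Subst t x u r →
         Γ₁ ∣ Δ₁ ⊢ u ∶ § A → Γ₂ ∣ (x , § A) ∷ Δ₂ ⊢ t ∶ B →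
         Γ₁ ++ Γ₂ ∣ Δ₁ ++ Δ₂ ⊢ r ∶ B
  -- side condition "α not free in Γ,Δ" in de Bruijn form
  ∀i   : ∀ {Γ Δ t A} → shiftCtx Γ ∣ shiftCtx Δ ⊢ t ∶ A → Γ ∣ Δ ⊢ t ∶ ∀' A
  ∀e   : ∀ {Γ Δ t A} (B : Ty) → Γ ∣ Δ ⊢ t ∶ ∀' A → Γ ∣ Δ ⊢ t ∶ tsubst0 A B
  B₀i  : [] ∣ [] ⊢ nF ∶ BoolTy
  B₁i  : [] ∣ [] ⊢ nT ∶ BoolTy
  Be   : ∀ {Γ Δ M₀ M₁ M₂ A} (k : ℕ) → Γ ∣ Δ ⊢ M₀ ∶ §^ k BoolTy →
         Γ ∣ Δ ⊢ M₁ ∶ A → Γ ∣ Δ ⊢ M₂ ∶ A →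
         Γ ∣ Δ ⊢ nite M₀ M₁ M₂ ∶ A
  -- contexts are sets of declarations (order irrelevant)
  Exch : ∀ {Γ Γ' Δ Δ' t A} → Γ ↭ Γ' → Δ ↭ Δ' → Γ ∣ Δ ⊢ t ∶ A → Γ' ∣ Δ' ⊢ t ∶ A

index : List ℕ → ℕ → Maybe ℕ
index []       x = nothing
index (y ∷ ys) x = if x ≡ᵇ y then just 0 else Maybe.map suc (index ys x)

toDB : List ℕ → NTerm → Maybe Term
toDB env (nvar x)     = Maybe.map var (index env x)
toDB env nF           = just F
toDB env nT           = just T
toDB env (nlam x t)   = Maybe.map lam (toDB (x ∷ env) t)
toDB env (napp t u)   = toDB env t >>= λ t' → toDB env u >>= λ u' → just (app t' u')
toDB env (nite t u v) = toDB env t >>= λ t' → toDB env u >>= λ u' →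
                        toDB env v >>= λ v' → just (ite t' u' v')

-- M is a program: (an α-representative of) M has type §ⁿ Bool in ; ⊢
Program : Term → Set
Program M = Σ ℕ λ n → Σ NTerm λ M' → (toDB [] M' ≡ just M) × ([] ∣ [] ⊢ M' ∶ §^ n BoolTy)

apps : Term → List Term → Term
apps t []       = t
apps t (u ∷ us) = apps (app t u) us

-- Contexts [x₁:=t₁,…,xₙ:=tₙ] are stored newest-first: tₙ ∷ … ∷ t₁ ∷ [].
-- The entry at position i (0 = newest) lives in the scope of the older
-- entries; de Bruijn index i in a configuration term refers to it.
MCtx : Set
MCtx = List Term

lookupCtx : MCtx → ℕ → Maybe Term
lookupCtx []      i       = nothing
lookupCtx (u ∷ A) zero    = just u
lookupCtx (u ∷ A) (suc i) = lookupCtx A i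

-- (t)^A = t[tₙ/xₙ]⋯[t₁/x₁]
close : MCtx → Term → Term
close []      t = t
close (u ∷ A) t = close A (t [ u ])

data Config : Set where
  rejecting : Config
  accepting : Config
  ex  : MCtx → Answer → Term → Config                     -- [[(∃) A | {b;t}]]
  all : MCtx → Answer → Term → Answer → Term → Config     -- [[(∀) A | {b;t}{b';t'}]]

data _↦_ : Config → Config → Set where
  βstep : ∀ {A b N N₁ Ns} →
          ex A b (apps (lam N) (N₁ ∷ Ns)) ↦ ex (N₁ ∷ A) b (apps N (map (weaken 1) Ns))
  hstep : ∀ {A b i N Ns} → lookupCtx A i ≡ just N →
          ex A b (apps (var i) Ns) ↦ ex A b (apps (weaken (suc i) N) Ns)
  if-yes : ∀ {A b M₀ M₁ M₂ Ns} →
          ex A b (apps (ite M₀ M₁ M₂) Ns) ↦ all A Yes M₀ b (apps M₁ Ns)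
  if-no : ∀ {A b M₀ M₁ M₂ Ns} →
          ex A b (apps (ite M₀ M₁ M₂) Ns) ↦ all A No M₀ b (apps M₂ Ns)
  if′ˡ  : ∀ {A a M₀ b N} → all A a M₀ b N ↦ ex A a M₀
  if′ʳ  : ∀ {A a M₀ b N} → all A a M₀ b N ↦ ex A b N
  acc-yes : ∀ {A} → ex A Yes T ↦ accepting
  acc-no  : ∀ {A} → ex A No F ↦ accepting
  rej-yes : ∀ {A} → ex A Yes F ↦ rejecting
  rej-no  : ∀ {A} → ex A No T ↦ rejecting

data Reachable (M : Term) : Config → Set where
  start : Reachable M (ex [] Yes M)
  next  : ∀ {c c'} → Reachable M c → c ↦ c' → Reachable M c'

data Accepts : Config → Set where
  accept  : Accepts accepting
  acc-∃   : ∀ {A b t c'} → ex A b t ↦ c' → Accepts c' → Accepts (ex A b t)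
  acc-∀   : ∀ {A b t b' t'} → (∀ {c'} → all A b t b' t' ↦ c' → Accepts c') →
            Accepts (all A b t b' t')

-- Writing  s ↠ v  for βδ-reduction of s to a Boolean value v, the proof shows
-- that every configuration [[(∃) A | {b;t}]] is accepted iff (t)^A ↠ ⌜b⌝, and
-- every [[(∀) A | {b;t}{b';t'}]] iff both (t)^A ↠ ⌜b⌝ and (t')^A ↠ ⌜b'⌝.  This
-- holds for all configurations.

module Submission where

open import Defs
open import Data.Product using (_×_)
open import Relation.Binary.PropositionalEquality using (_≡_)
open import Function.Bundles using (_⇔_)

open import Data.Bool using (true; false; if_then_else_)
open import Data.Empty using (⊥; ⊥-elim)
open import Data.Unit using (⊤; tt)
open import Data.List using (List; []; _∷_; map; length)
open import Data.Maybe using (just; nothing)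
open import Data.Nat using (ℕ; zero; suc; _+_; _≡ᵇ_; _<ᵇ_; _≤_; _<_; s≤s; z≤n)
open import Data.Nat.Properties
  using (+-suc; +-identityʳ; m≤n+m; +-monoˡ-≤; ≤-trans; ≤-reflexive; <⇒≱)
open import Data.Product using (Σ; _,_)
open import Function.Bundles using (mk⇔)
open import Relation.Binary.PropositionalEquality
  using (refl; sym; trans; cong; cong₂; subst; subst₂; _≗_; module ≡-Reasoning)
open import Relation.Binary.Construct.Closure.ReflexiveTransitive
  using (Star; ε; _◅_; _◅◅_; gmap; _⋆)

cong₃ : ∀ {A B C D : Set} (f : A → B → C → D) {a a' b b' c c'} →
        a ≡ a' → b ≡ b' → c ≡ c' → f a b c ≡ f a' b' c'
cong₃ f refl refl refl = refl

-- Renamings and substitutions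

Ren : Set
Ren = ℕ → ℕ

Sub : Set
Sub = ℕ → Term

ext : Ren → Ren
ext ρ zero    = zero
ext ρ (suc x) = suc (ρ x)

ren : Ren → Term → Term
ren ρ (var x)     = var (ρ x)
ren ρ F           = F
ren ρ T           = T
ren ρ (lam t)     = lam (ren (ext ρ) t)
ren ρ (app t u)   = app (ren ρ t) (ren ρ u)
ren ρ (ite t u v) = ite (ren ρ t) (ren ρ u) (ren ρ v)

exts : Sub → Sub
exts σ zero    = var zero
exts σ (suc x) = ren suc (σ x)

sub : Sub → Term → Term
sub σ (var x)     = σ x
sub σ F           = F
sub σ T           = T
sub σ (lam t)     = lam (sub (exts σ) t)
sub σ (app t u)   = app (sub σ t) (sub σ u)
sub σ (ite t u v) = ite (sub σ t) (sub σ u) (sub σ v)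

σ₀ : Term → Sub
σ₀ u zero    = u
σ₀ u (suc x) = var x

ren-cong : ∀ {ρ ρ'} → ρ ≗ ρ' → ∀ t → ren ρ t ≡ ren ρ' t
ren-cong e (var x)     = cong var (e x)
ren-cong e F           = refl
ren-cong e T           = refl
ren-cong e (lam t)     = cong lam (ren-cong ext-e t)
  where ext-e : ext _ ≗ ext _
        ext-e zero    = refl
        ext-e (suc x) = cong suc (e x)
ren-cong e (app t u)   = cong₂ app (ren-cong e t) (ren-cong e u)
ren-cong e (ite t u v) = cong₃ ite (ren-cong e t) (ren-cong e u) (ren-cong e v)

sub-cong : ∀ {σ σ'} → σ ≗ σ' → ∀ t → sub σ t ≡ sub σ' t
sub-cong e (var x)     = e x
sub-cong e F           = refl
sub-cong e T           = refl
sub-cong e (lam t)     = cong lam (sub-cong exts-e t)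
  where exts-e : exts _ ≗ exts _
        exts-e zero    = refl
        exts-e (suc x) = cong (ren suc) (e x)
sub-cong e (app t u)   = cong₂ app (sub-cong e t) (sub-cong e u)
sub-cong e (ite t u v) = cong₃ ite (sub-cong e t) (sub-cong e u) (sub-cong e v)

ren-ren : ∀ ρ ρ' t → ren ρ (ren ρ' t) ≡ ren (λ x → ρ (ρ' x)) t
ren-ren ρ ρ' (var x)     = refl
ren-ren ρ ρ' F           = refl
ren-ren ρ ρ' T           = refl
ren-ren ρ ρ' (lam t)     = cong lam (trans (ren-ren (ext ρ) (ext ρ') t)
                                           (ren-cong (λ { zero → refl ; (suc x) → refl }) t))
ren-ren ρ ρ' (app t u)   = cong₂ app (ren-ren ρ ρ' t) (ren-ren ρ ρ' u)
ren-ren ρ ρ' (ite t u v) = cong₃ ite (ren-ren ρ ρ' t) (ren-ren ρ ρ' u) (ren-ren ρ ρ' v)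

sub-ren : ∀ σ ρ t → sub σ (ren ρ t) ≡ sub (λ x → σ (ρ x)) t
sub-ren σ ρ (var x)     = refl
sub-ren σ ρ F           = refl
sub-ren σ ρ T           = refl
sub-ren σ ρ (lam t)     = cong lam (trans (sub-ren (exts σ) (ext ρ) t)
                                           (sub-cong (λ { zero → refl ; (suc x) → refl }) t))
sub-ren σ ρ (app t u)   = cong₂ app (sub-ren σ ρ t) (sub-ren σ ρ u)
sub-ren σ ρ (ite t u v) = cong₃ ite (sub-ren σ ρ t) (sub-ren σ ρ u) (sub-ren σ ρ v)

ren-sub : ∀ ρ σ t → ren ρ (sub σ t) ≡ sub (λ x → ren ρ (σ x)) t
ren-sub ρ σ (var x)     = refl
ren-sub ρ σ F           = refl
ren-sub ρ σ T           = refl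
ren-sub ρ σ (lam t)     = cong lam (trans (ren-sub (ext ρ) (exts σ) t) (sub-cong lifted t))
  where lifted : (λ x → ren (ext ρ) (exts σ x)) ≗ exts (λ x → ren ρ (σ x))
        lifted zero    = refl
        lifted (suc x) = trans (ren-ren (ext ρ) suc (σ x)) (sym (ren-ren suc ρ (σ x)))
ren-sub ρ σ (app t u)   = cong₂ app (ren-sub ρ σ t) (ren-sub ρ σ u)
ren-sub ρ σ (ite t u v) = cong₃ ite (ren-sub ρ σ t) (ren-sub ρ σ u) (ren-sub ρ σ v)

sub-sub : ∀ σ τ t → sub σ (sub τ t) ≡ sub (λ x → sub σ (τ x)) t
sub-sub σ τ (var x)     = refl
sub-sub σ τ F           = refl
sub-sub σ τ T           = refl
sub-sub σ τ (lam t)     = cong lam (trans (sub-sub (exts σ) (exts τ) t) (sub-cong lifted t))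
  where lifted : (λ x → sub (exts σ) (exts τ x)) ≗ exts (λ x → sub σ (τ x))
        lifted zero    = refl
        lifted (suc x) = trans (sub-ren (exts σ) suc (τ x)) (sym (ren-sub suc σ (τ x)))
sub-sub σ τ (app t u)   = cong₂ app (sub-sub σ τ t) (sub-sub σ τ u)
sub-sub σ τ (ite t u v) = cong₃ ite (sub-sub σ τ t) (sub-sub σ τ u) (sub-sub σ τ v)

sub-id : ∀ {σ} → (∀ x → σ x ≡ var x) → ∀ t → sub σ t ≡ t
sub-id e (var x)     = e x
sub-id e F           = refl
sub-id e T           = refl
sub-id e (lam t)     = cong lam (sub-id lifted t)
  where lifted : ∀ x → exts _ x ≡ var x
        lifted zero    = refl
        lifted (suc x) = cong (ren suc) (e x)
sub-id e (app t u)   = cong₂ app (sub-id e t) (sub-id e u)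
sub-id e (ite t u v) = cong₃ ite (sub-id e t) (sub-id e u) (sub-id e v)

ren-as-sub : ∀ ρ t → ren ρ t ≡ sub (λ x → var (ρ x)) t
ren-as-sub ρ (var x)     = refl
ren-as-sub ρ F           = refl
ren-as-sub ρ T           = refl
ren-as-sub ρ (lam t)     = cong lam (trans (ren-as-sub (ext ρ) t)
                                           (sub-cong (λ { zero → refl ; (suc x) → refl }) t))
ren-as-sub ρ (app t u)   = cong₂ app (ren-as-sub ρ t) (ren-as-sub ρ u)
ren-as-sub ρ (ite t u v) = cong₃ ite (ren-as-sub ρ t) (ren-as-sub ρ u) (ren-as-sub ρ v)

-- The operations of Defs as instances

ext^ : ℕ → Ren → Ren
ext^ zero    ρ = ρ
ext^ (suc c) ρ = ext (ext^ c ρ)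

exts^ : ℕ → Sub → Sub
exts^ zero    σ = σ
exts^ (suc k) σ = exts (exts^ k σ)

_+ᵣ : ℕ → Ren
(d +ᵣ) x = x + d

shift-var : ∀ c d i → (if i <ᵇ c then var i else var (i + d)) ≡ var (ext^ c (d +ᵣ) i)
shift-var zero    d i       = refl
shift-var (suc c) d zero    = refl
shift-var (suc c) d (suc i) with i <ᵇ c | shift-var c d i
... | true  | e = cong (ren suc) e
... | false | e = cong (ren suc) e

shift-ren : ∀ c d t → shift c d t ≡ ren (ext^ c (d +ᵣ)) t
shift-ren c d (var i)     = shift-var c d i
shift-ren c d F           = refl
shift-ren c d T           = refl
shift-ren c d (lam t)     = cong lam (shift-ren (suc c) d t)
shift-ren c d (app t u)   = cong₂ app (shift-ren c d t) (shift-ren c d u)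
shift-ren c d (ite t u v) = cong₃ ite (shift-ren c d t) (shift-ren c d u) (shift-ren c d v)

weaken-ren : ∀ k t → weaken k t ≡ ren (k +ᵣ) t
weaken-ren k t = shift-ren 0 k t

weaken-zero : ∀ t → weaken 0 t ≡ t
weaken-zero t = begin
  weaken 0 t                     ≡⟨ weaken-ren 0 t ⟩
  ren (0 +ᵣ) t                   ≡⟨ ren-as-sub (0 +ᵣ) t ⟩
  sub (λ x → var (x + 0)) t      ≡⟨ sub-id (λ x → cong var (+-identityʳ x)) t ⟩
  t                              ∎
  where open ≡-Reasoning

weaken-suc : ∀ k u → weaken (suc k) u ≡ ren suc (weaken k u)
weaken-suc k u = begin
  weaken (suc k) u               ≡⟨ weaken-ren (suc k) u ⟩
  ren (suc k +ᵣ) u               ≡⟨ ren-cong (λ x → +-suc x k) u ⟩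
  ren (λ x → suc (x + k)) u      ≡⟨ sym (ren-ren suc (k +ᵣ) u) ⟩
  ren suc (ren (k +ᵣ) u)         ≡⟨ cong (ren suc) (sym (weaken-ren k u)) ⟩
  ren suc (weaken k u)           ∎
  where open ≡-Reasoning

substAt-var-suc : ∀ k u i →
  substAt (suc k) u (var (suc i)) ≡ ren suc (substAt k u (var i))
substAt-var-suc zero    u zero    = weaken-suc 0 u
substAt-var-suc (suc k) u zero    = refl
substAt-var-suc k       u (suc i) = by-cases (suc i ≡ᵇ k) (suc i <ᵇ k)
  where
    by-cases : ∀ b₁ b₂ →
      (if b₁ then weaken (suc k) u else (if b₂ then var (suc (suc i)) else var (suc i)))
      ≡ ren suc (if b₁ then weaken k u else (if b₂ then var (suc i) else var i))
    by-cases true  _     = weaken-suc k u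
    by-cases false true  = refl
    by-cases false false = refl

substAt-var : ∀ k u i → substAt k u (var i) ≡ exts^ k (σ₀ u) i
substAt-var zero    u zero    = weaken-zero u
substAt-var zero    u (suc i) = refl
substAt-var (suc k) u zero    = refl
substAt-var (suc k) u (suc i) =
  trans (substAt-var-suc k u i) (cong (ren suc) (substAt-var k u i))

substAt-sub : ∀ k u t → substAt k u t ≡ sub (exts^ k (σ₀ u)) t
substAt-sub k u (var i)     = substAt-var k u i
substAt-sub k u F           = refl
substAt-sub k u T           = refl
substAt-sub k u (lam t)     = cong lam (substAt-sub (suc k) u t)
substAt-sub k u (app t v)   = cong₂ app (substAt-sub k u t) (substAt-sub k u v)
substAt-sub k u (ite t v w) = cong₃ ite (substAt-sub k u t) (substAt-sub k u v) (substAt-sub k u w)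

[]-sub : ∀ t u → t [ u ] ≡ sub (σ₀ u) t
[]-sub t u = substAt-sub 0 u t

sub-[] : ∀ σ t u → sub σ (t [ u ]) ≡ (sub (exts σ) t) [ sub σ u ]
sub-[] σ t u = begin
  sub σ (t [ u ])                                 ≡⟨ cong (sub σ) ([]-sub t u) ⟩
  sub σ (sub (σ₀ u) t)                            ≡⟨ sub-sub σ (σ₀ u) t ⟩
  sub (λ x → sub σ (σ₀ u x)) t                    ≡⟨ sub-cong pointwise t ⟩
  sub (λ x → sub (σ₀ (sub σ u)) (exts σ x)) t     ≡⟨ sym (sub-sub _ (exts σ) t) ⟩
  sub (σ₀ (sub σ u)) (sub (exts σ) t)             ≡⟨ sym ([]-sub (sub (exts σ) t) (sub σ u)) ⟩
  (sub (exts σ) t) [ sub σ u ]                    ∎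
  where
    open ≡-Reasoning
    pointwise : (λ x → sub σ (σ₀ u x)) ≗ (λ x → sub (σ₀ (sub σ u)) (exts σ x))
    pointwise zero    = refl
    pointwise (suc x) = sym (trans (sub-ren _ suc (σ x)) (sub-id (λ _ → refl) (σ x)))

ren-[] : ∀ ρ t u → ren ρ (t [ u ]) ≡ (ren (ext ρ) t) [ ren ρ u ]
ren-[] ρ t u = begin
  ren ρ (t [ u ])                                 ≡⟨ ren-as-sub ρ _ ⟩
  sub (λ x → var (ρ x)) (t [ u ])                 ≡⟨ sub-[] _ t u ⟩
  (sub (exts (λ x → var (ρ x))) t) [ sub _ u ]    ≡⟨ cong₂ _[_] lifted (sym (ren-as-sub ρ u)) ⟩
  (ren (ext ρ) t) [ ren ρ u ]                     ∎
  where
    open ≡-Reasoning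
    lifted : sub (exts (λ x → var (ρ x))) t ≡ ren (ext ρ) t
    lifted = trans (sub-cong (λ { zero → refl ; (suc x) → refl }) t)
                   (sym (ren-as-sub (ext ρ) t))

weaken-[] : ∀ k x u → (weaken (suc k) x) [ u ] ≡ weaken k x
weaken-[] k x u = begin
  (weaken (suc k) x) [ u ]             ≡⟨ []-sub (weaken (suc k) x) u ⟩
  sub (σ₀ u) (weaken (suc k) x)        ≡⟨ cong (sub (σ₀ u)) (weaken-ren (suc k) x) ⟩
  sub (σ₀ u) (ren (suc k +ᵣ) x)        ≡⟨ sub-ren (σ₀ u) (suc k +ᵣ) x ⟩
  sub (λ y → σ₀ u (y + suc k)) x       ≡⟨ sub-cong (λ y → cong (σ₀ u) (+-suc y k)) x ⟩
  sub (λ y → var (y + k)) x            ≡⟨ sym (ren-as-sub (k +ᵣ) x) ⟩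
  ren (k +ᵣ) x                         ≡⟨ sym (weaken-ren k x) ⟩
  weaken k x                           ∎
  where open ≡-Reasoning

-- Closing a term under a machine context

-- (λ.N)^A = λ.(closeUnder A N): the entries are substituted at index 1
closeUnder : MCtx → Term → Term
closeUnder []      N = N
closeUnder (u ∷ A) N = closeUnder A (substAt 1 u N)

closeHead : MCtx → Term → Term
closeHead A (var i)     = close A (var i)
closeHead A F           = F
closeHead A T           = T
closeHead A (lam N)     = lam (closeUnder A N)
closeHead A (app t u)   = app (close A t) (close A u)
closeHead A (ite t u v) = ite (close A t) (close A u) (close A v)

close-head : ∀ A t → close A t ≡ closeHead A t
close-head A       (var i)     = refl
close-head []      F           = refl
close-head []      T           = refl
close-head []      (lam N)     = refl
close-head []      (app t u)   = refl
close-head []      (ite t u v) = refl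
close-head (w ∷ A) F           = close-head A F
close-head (w ∷ A) T           = close-head A T
close-head (w ∷ A) (lam N)     = close-head A (lam (substAt 1 w N))
close-head (w ∷ A) (app t u)   = close-head A (app (t [ w ]) (u [ w ]))
close-head (w ∷ A) (ite t u v) = close-head A (ite (t [ w ]) (u [ w ]) (v [ w ]))

close-apps : ∀ A t Ns → close A (apps t Ns) ≡ apps (close A t) (map (close A) Ns)
close-apps A t []       = refl
close-apps A t (u ∷ Ns) =
  trans (close-apps A (app t u) Ns)
        (cong (λ h → apps h (map (close A) Ns)) (close-head A (app t u)))

close-β : ∀ A N N₁ → close (N₁ ∷ A) N ≡ (closeUnder A N) [ close A N₁ ]
close-β []      N N₁ = refl
close-β (v ∷ A) N N₁ =
  trans (cong (close A) commute) (close-β A (substAt 1 v N) (N₁ [ v ]))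
  where
    commute : (N [ N₁ ]) [ v ] ≡ (substAt 1 v N) [ N₁ [ v ] ]
    commute = begin
      (N [ N₁ ]) [ v ]                               ≡⟨ []-sub (N [ N₁ ]) v ⟩
      sub (σ₀ v) (N [ N₁ ])                          ≡⟨ sub-[] (σ₀ v) N N₁ ⟩
      (sub (exts (σ₀ v)) N) [ sub (σ₀ v) N₁ ]        ≡⟨ cong₂ _[_] (sym (substAt-sub 1 v N))
                                                                   (sym ([]-sub N₁ v)) ⟩
      (substAt 1 v N) [ N₁ [ v ] ]                   ∎
      where open ≡-Reasoning

close-weaken : ∀ A N₁ Ns → map (close (N₁ ∷ A)) (map (weaken 1) Ns) ≡ map (close A) Ns
close-weaken A N₁ []       = refl
close-weaken A N₁ (x ∷ Ns) =
  cong₂ _∷_ (cong (close A) (trans (weaken-[] 0 x N₁) (weaken-zero x))) (close-weaken A N₁ Ns)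

close-lookup : ∀ A i {N} → lookupCtx A i ≡ just N → close A (var i) ≡ close A (weaken (suc i) N)
close-lookup (u ∷ A) zero    refl = cong (close A) (sym (weaken-[] 0 u u))
close-lookup (u ∷ A) (suc i) {N} e =
  trans (close-lookup A i e) (cong (close A) (sym (weaken-[] (suc i) N u)))

close-free : ∀ A i → lookupCtx A i ≡ nothing → Σ ℕ λ j → close A (var i) ≡ var j
close-free []      i       e = i , refl
close-free (u ∷ A) (suc i) e = close-free A i e

lookup-< : ∀ A i {N} → lookupCtx A i ≡ just N → i < length A
lookup-< (u ∷ A) zero    e = s≤s z≤n
lookup-< (u ∷ A) (suc i) e = s≤s (lookup-< A i e)

-- Confluence via parallel reduction

infix 4 _⇛_
data _⇛_ : Term → Term → Set where
  pvar : ∀ {x} → var x ⇛ var x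
  pT   : T ⇛ T
  pF   : F ⇛ F
  plam : ∀ {t t'} → t ⇛ t' → lam t ⇛ lam t'
  papp : ∀ {t t' u u'} → t ⇛ t' → u ⇛ u' → app t u ⇛ app t' u'
  pite : ∀ {t t' u u' v v'} → t ⇛ t' → u ⇛ u' → v ⇛ v' → ite t u v ⇛ ite t' u' v'
  pβ   : ∀ {t t' u u'} → t ⇛ t' → u ⇛ u' → app (lam t) u ⇛ t' [ u' ]
  pδT  : ∀ {u u' v} → u ⇛ u' → ite T u v ⇛ u'
  pδF  : ∀ {u v v'} → v ⇛ v' → ite F u v ⇛ v'

par-refl : ∀ t → t ⇛ t
par-refl (var x)     = pvar
par-refl F           = pF
par-refl T           = pT
par-refl (lam t)     = plam (par-refl t)
par-refl (app t u)   = papp (par-refl t) (par-refl u)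
par-refl (ite t u v) = pite (par-refl t) (par-refl u) (par-refl v)

par-ren : ∀ ρ {t t'} → t ⇛ t' → ren ρ t ⇛ ren ρ t'
par-ren ρ pvar         = pvar
par-ren ρ pT           = pT
par-ren ρ pF           = pF
par-ren ρ (plam p)     = plam (par-ren (ext ρ) p)
par-ren ρ (papp p q)   = papp (par-ren ρ p) (par-ren ρ q)
par-ren ρ (pite p q r) = pite (par-ren ρ p) (par-ren ρ q) (par-ren ρ r)
par-ren ρ (pβ {t' = t'} {u' = u'} p q) =
  subst (_ ⇛_) (sym (ren-[] ρ t' u')) (pβ (par-ren (ext ρ) p) (par-ren ρ q))
par-ren ρ (pδT p)      = pδT (par-ren ρ p)
par-ren ρ (pδF p)      = pδF (par-ren ρ p)

par-exts : ∀ {σ τ} → (∀ x → σ x ⇛ τ x) → ∀ x → exts σ x ⇛ exts τ x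
par-exts h zero    = pvar
par-exts h (suc x) = par-ren suc (h x)

par-sub : ∀ {σ τ} → (∀ x → σ x ⇛ τ x) → ∀ {t t'} → t ⇛ t' → sub σ t ⇛ sub τ t'
par-sub h (pvar {x})   = h x
par-sub h pT           = pT
par-sub h pF           = pF
par-sub h (plam p)     = plam (par-sub (par-exts h) p)
par-sub h (papp p q)   = papp (par-sub h p) (par-sub h q)
par-sub h (pite p q r) = pite (par-sub h p) (par-sub h q) (par-sub h r)
par-sub {τ = τ} h (pβ {t' = t'} {u' = u'} p q) =
  subst (_ ⇛_) (sym (sub-[] τ t' u')) (pβ (par-sub (par-exts h) p) (par-sub h q))
par-sub h (pδT p)      = pδT (par-sub h p)
par-sub h (pδF p)      = pδF (par-sub h p)

par-σ₀ : ∀ {u u'} → u ⇛ u' → ∀ x → σ₀ u x ⇛ σ₀ u' x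
par-σ₀ q zero    = q
par-σ₀ q (suc x) = pvar

par-[] : ∀ {t t' u u'} → t ⇛ t' → u ⇛ u' → t [ u ] ⇛ t' [ u' ]
par-[] {t} {t'} {u} {u'} p q =
  subst₂ _⇛_ (sym ([]-sub t u)) (sym ([]-sub t' u')) (par-sub (par-σ₀ q) p)

dev : Term → Term
dev (var x)                 = var x
dev F                       = F
dev T                       = T
dev (lam t)                 = lam (dev t)
dev (app (lam t) u)         = (dev t) [ dev u ]
dev (app (var x) u)         = app (var x) (dev u)
dev (app F u)               = app F (dev u)
dev (app T u)               = app T (dev u)
dev (app (app t t₁) u)      = app (dev (app t t₁)) (dev u)
dev (app (ite t t₁ t₂) u)   = app (dev (ite t t₁ t₂)) (dev u)
dev (ite T u v)             = dev u
dev (ite F u v)             = dev v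
dev (ite (var x) u v)       = ite (var x) (dev u) (dev v)
dev (ite (lam t) u v)       = ite (dev (lam t)) (dev u) (dev v)
dev (ite (app t t₁) u v)    = ite (dev (app t t₁)) (dev u) (dev v)
dev (ite (ite t t₁ t₂) u v) = ite (dev (ite t t₁ t₂)) (dev u) (dev v)

triangle : ∀ {t t'} → t ⇛ t' → t' ⇛ dev t
triangle pvar                         = pvar
triangle pT                           = pT
triangle pF                           = pF
triangle (plam p)                     = plam (triangle p)
triangle (papp (plam p) q)            = pβ (triangle p) (triangle q)
triangle (papp pvar q)                = papp pvar (triangle q)
triangle (papp pT q)                  = papp pT (triangle q)
triangle (papp pF q)                  = papp pF (triangle q)
triangle (papp p@(papp _ _) q)        = papp (triangle p) (triangle q)
triangle (papp p@(pβ _ _) q)          = papp (triangle p) (triangle q)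
triangle (papp p@(pite _ _ _) q)      = papp (triangle p) (triangle q)
triangle (papp p@(pδT _) q)           = papp (triangle p) (triangle q)
triangle (papp p@(pδF _) q)           = papp (triangle p) (triangle q)
triangle (pβ p q)                     = par-[] (triangle p) (triangle q)
triangle (pite pT q r)                = pδT (triangle q)
triangle (pite pF q r)                = pδF (triangle r)
triangle (pite pvar q r)              = pite pvar (triangle q) (triangle r)
triangle (pite p@(plam _) q r)        = pite (triangle p) (triangle q) (triangle r)
triangle (pite p@(papp _ _) q r)      = pite (triangle p) (triangle q) (triangle r)
triangle (pite p@(pβ _ _) q r)        = pite (triangle p) (triangle q) (triangle r)
triangle (pite p@(pite _ _ _) q r)    = pite (triangle p) (triangle q) (triangle r)
triangle (pite p@(pδT _) q r)         = pite (triangle p) (triangle q) (triangle r)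
triangle (pite p@(pδF _) q r)         = pite (triangle p) (triangle q) (triangle r)
triangle (pδT p)                      = triangle p
triangle (pδF p)                      = triangle p

infix 4 _⇛*_
_⇛*_ : Term → Term → Set
_⇛*_ = Star _⇛_

-- strip lemma and confluence of ⇛*, by repeatedly completing to developments
strip : ∀ {t t₁ t₂} → t ⇛ t₁ → t ⇛* t₂ → Σ Term λ w → (t₁ ⇛* w) × (t₂ ⇛ w)
strip {t₁ = t₁} p ε = t₁ , ε , p
strip p (q ◅ qs) with strip (triangle q) qs
... | w , p* , q' = w , (triangle p ◅ p*) , q'

par*-confluent : ∀ {t t₁ t₂} → t ⇛* t₁ → t ⇛* t₂ → Σ Term λ w → (t₁ ⇛* w) × (t₂ ⇛* w)
par*-confluent {t₂ = t₂} ε qs = t₂ , qs , ε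
par*-confluent (p ◅ ps) qs with strip p qs
... | w₁ , p* , q with par*-confluent ps p*
...   | w , ps' , qs' = w , ps' , (q ◅ qs')

-- ⟶ ⊆ ⇛ ⊆ ⟶*, so ⇛* and ⟶* coincide

step→par : ∀ {t t'} → t ⟶ t' → t ⇛ t'
step→par β         = pβ (par-refl _) (par-refl _)
step→par δT        = pδT (par-refl _)
step→par δF        = pδF (par-refl _)
step→par (ξlam s)  = plam (step→par s)
step→par (ξappˡ s) = papp (step→par s) (par-refl _)
step→par (ξappʳ s) = papp (par-refl _) (step→par s)
step→par (ξite₀ s) = pite (step→par s) (par-refl _) (par-refl _)
step→par (ξite₁ s) = pite (par-refl _) (step→par s) (par-refl _)
step→par (ξite₂ s) = pite (par-refl _) (par-refl _) (step→par s)

par→steps : ∀ {t t'} → t ⇛ t' → t ⟶* t'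
par→steps pvar         = ε
par→steps pT           = ε
par→steps pF           = ε
par→steps (plam p)     = gmap lam ξlam (par→steps p)
par→steps (papp p q)   =
  gmap (λ t → app t _) ξappˡ (par→steps p) ◅◅ gmap (app _) ξappʳ (par→steps q)
par→steps (pite p q r) =
  gmap (λ t → ite t _ _) ξite₀ (par→steps p) ◅◅
  gmap (λ u → ite _ u _) ξite₁ (par→steps q) ◅◅ gmap (ite _ _) ξite₂ (par→steps r)
par→steps (pβ p q)     =
  gmap (λ t → app (lam t) _) (λ s → ξappˡ (ξlam s)) (par→steps p) ◅◅
  gmap (app _) ξappʳ (par→steps q) ◅◅ β ◅ ε
par→steps (pδT p)      = δT ◅ par→steps p
par→steps (pδF p)      = δF ◅ par→steps p

steps→par* : ∀ {t t'} → t ⟶* t' → t ⇛* t'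
steps→par* = gmap (λ t → t) step→par

par*→steps : ∀ {t t'} → t ⇛* t' → t ⟶* t'
par*→steps = par→steps ⋆

normal-stuck : ∀ {n w} → Normal n → n ⟶* w → w ≡ n
normal-stuck nn ε        = refl
normal-stuck nn (s ◅ ss) = ⊥-elim (nn _ s)

normal-unique : ∀ {s n n'} → s ⟶* n → Normal n → s ⟶* n' → Normal n' → n' ≡ n
normal-unique r nn r' nn' with par*-confluent (steps→par* r) (steps→par* r')
... | w , p , p' = trans (sym (normal-stuck nn' (par*→steps p'))) (normal-stuck nn (par*→steps p))

value-normal : ∀ b → Normal ⌜ b ⌝
value-normal Yes u ()
value-normal No  u ()

←-reduces : ∀ {s b} → b ← s → s ⟶* ⌜ b ⌝
←-reduces (_ , (r , _ , _) , refl) = r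

reduces-← : ∀ {s b} → s ⟶* ⌜ b ⌝ → b ← s
reduces-← {b = b} r =
  ⌜ b ⌝ , (r , value-normal b , λ n' r' nn' → normal-unique r (value-normal b) r' nn') , refl

-- Standardization for Boolean values

infix 4 _→h_
data _→h_ : Term → Term → Set where
  hβ   : ∀ {N u} → app (lam N) u →h N [ u ]
  hT   : ∀ {u v} → ite T u v →h u
  hF   : ∀ {u v} → ite F u v →h v
  happ : ∀ {t t' u} → t →h t' → app t u →h app t' u
  hite : ∀ {t t' u v} → t →h t' → ite t u v →h ite t' u v

infix 4 _→h*_
_→h*_ : Term → Term → Set
_→h*_ = Star _→h_

head-sub : ∀ σ {s s'} → s →h s' → sub σ s →h sub σ s'
head-sub σ (hβ {N} {u}) = subst (sub σ (app (lam N) u) →h_) (sym (sub-[] σ N u)) hβ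
head-sub σ hT           = hT
head-sub σ hF           = hF
head-sub σ (happ s)     = happ (head-sub σ s)
head-sub σ (hite s)     = hite (head-sub σ s)

head*-[] : ∀ {t w} u → t →h* w → t [ u ] →h* w [ u ]
head*-[] {t} {w} u r =
  subst₂ _→h*_ (sym ([]-sub t u)) (sym ([]-sub w u)) (gmap (sub (σ₀ u)) (head-sub (σ₀ u)) r)

-- internal parallel reduction: parallel reduction contracting no head redex
infix 4 _⇛ᵢ_
data _⇛ᵢ_ : Term → Term → Set where
  ivar : ∀ {x} → var x ⇛ᵢ var x
  iT   : T ⇛ᵢ T
  iF   : F ⇛ᵢ F
  ilam : ∀ {t t'} → t ⇛ t' → lam t ⇛ᵢ lam t'
  iapp : ∀ {t t' u u'} → t ⇛ᵢ t' → u ⇛ u' → app t u ⇛ᵢ app t' u'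
  iite : ∀ {t t' u u' v v'} → t ⇛ᵢ t' → u ⇛ u' → v ⇛ v' → ite t u v ⇛ᵢ ite t' u' v'

internal→par : ∀ {s t} → s ⇛ᵢ t → s ⇛ t
internal→par ivar         = pvar
internal→par iT           = pT
internal→par iF           = pF
internal→par (ilam p)     = plam p
internal→par (iapp p q)   = papp (internal→par p) q
internal→par (iite p q r) = pite (internal→par p) q r

HeadThenInternal : Term → Term → Set
HeadThenInternal s t = Σ Term λ w → (s →h* w) × (w ⇛ᵢ t)

sub-split : ∀ {σ τ} → (∀ x → σ x ⇛ τ x) → (∀ x → HeadThenInternal (σ x) (τ x)) →
            ∀ {p p'} → p ⇛ᵢ p' → HeadThenInternal (sub σ p) (sub τ p')
sub-split par split (ivar {x})   = split x
sub-split par split iT           = T , ε , iT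
sub-split par split iF           = F , ε , iF
sub-split par split (ilam p)     = _ , ε , ilam (par-sub (par-exts par) p)
sub-split par split (iapp p q) with sub-split par split p
... | w , h , i = app w _ , gmap (λ t → app t _) happ h , iapp i (par-sub par q)
sub-split par split (iite p q r) with sub-split par split p
... | w , h , i = ite w _ _ , gmap (λ t → ite t _ _) hite h , iite i (par-sub par q) (par-sub par r)

par-split : ∀ {s t} → s ⇛ t → HeadThenInternal s t
par-split pvar = _ , ε , ivar
par-split pT   = T , ε , iT
par-split pF   = F , ε , iF
par-split (plam p) = _ , ε , ilam p
par-split (papp p q) with par-split p
... | w , h , i = app w _ , gmap (λ t → app t _) happ h , iapp i q
par-split (pite p q r) with par-split p
... | w , h , i = ite w _ _ , gmap (λ t → ite t _ _) hite h , iite i q r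
par-split (pβ {t} {t'} {u} {u'} p q) with par-split p
... | w , h , i with sub-split (par-σ₀ q) split-σ₀ i
  where split-σ₀ : ∀ x → HeadThenInternal (σ₀ u x) (σ₀ u' x)
        split-σ₀ zero    = par-split q
        split-σ₀ (suc x) = var x , ε , ivar
...   | w' , h' , i' =
  w' , hβ ◅ (head*-[] u h ◅◅ subst (_→h* w') (sym ([]-sub w u)) h') ,
  subst (w' ⇛ᵢ_) (sym ([]-sub t' u')) i'
par-split (pδT p) with par-split p
... | w , h , i = w , hT ◅ h , i
par-split (pδF p) with par-split p
... | w , h , i = w , hF ◅ h , i

-- an internal step followed by a head step: do the head step first
internal-head-swap : ∀ {u t t'} → u ⇛ᵢ t → t →h t' → Σ Term λ w → (u →h w) × (w ⇛ t')
internal-head-swap (iapp (ilam p) q) hβ = _ , hβ , par-[] p q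
internal-head-swap (iite iT q r) hT     = _ , hT , q
internal-head-swap (iite iF q r) hF     = _ , hF , r
internal-head-swap (iapp p q) (happ s) with internal-head-swap p s
... | w , h , p' = app w _ , happ h , papp p' q
internal-head-swap (iite p q r) (hite s) with internal-head-swap p s
... | w , h , p' = ite w _ _ , hite h , pite p' q r

internal-value : ∀ {u} b → u ⇛ᵢ ⌜ b ⌝ → u ≡ ⌜ b ⌝
internal-value Yes iT = refl
internal-value No  iF = refl

par-head*-value : ∀ {s t} b → s ⇛ t → t →h* ⌜ b ⌝ → s →h* ⌜ b ⌝
par-head*-value b p ε with par-split p
... | w , h , i rewrite internal-value b i = h
par-head*-value b p (s ◅ ss) with par-split p
... | w , h , i with internal-head-swap i s
...   | w' , h' , p' = h ◅◅ h' ◅ par-head*-value b p' ss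

standardization : ∀ {s} b → s ⟶* ⌜ b ⌝ → s →h* ⌜ b ⌝
standardization b ε        = ε
standardization b (s ◅ ss) = par-head*-value b (step→par s) (standardization b ss)

-- Big-step evaluation with an argument stack

-- Ev s Ns b : the head reduction of  s N₁ ⋯ Nₚ  ends in ⌜ b ⌝
data Ev : Term → List Term → Answer → Set where
  ev-T   : Ev T [] Yes
  ev-F   : Ev F [] No
  ev-app : ∀ {t u Ns b} → Ev t (u ∷ Ns) b → Ev (app t u) Ns b
  ev-β   : ∀ {N u Ns b} → Ev (N [ u ]) Ns b → Ev (lam N) (u ∷ Ns) b
  ev-iT  : ∀ {M₀ M₁ M₂ Ns b} → Ev M₀ [] Yes → Ev M₁ Ns b → Ev (ite M₀ M₁ M₂) Ns b
  ev-iF  : ∀ {M₀ M₁ M₂ Ns b} → Ev M₀ [] No → Ev M₂ Ns b → Ev (ite M₀ M₁ M₂) Ns b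

ev-head-expand : ∀ {s s' Ns b} → s →h s' → Ev s' Ns b → Ev s Ns b
ev-head-expand hβ       d               = ev-app (ev-β d)
ev-head-expand hT       d               = ev-iT ev-T d
ev-head-expand hF       d               = ev-iF ev-F d
ev-head-expand (happ h) (ev-app d)      = ev-app (ev-head-expand h d)
ev-head-expand (hite h) (ev-iT d₀ d₁)   = ev-iT (ev-head-expand h d₀) d₁
ev-head-expand (hite h) (ev-iF d₀ d₁)   = ev-iF (ev-head-expand h d₀) d₁

head*→ev : ∀ {s} b → s →h* ⌜ b ⌝ → Ev s [] b
head*→ev Yes ε        = ev-T
head*→ev No  ε        = ev-F
head*→ev b   (h ◅ hs) = ev-head-expand h (head*→ev b hs)

-- Soundness of the machine

Valid : Config → Set
Valid rejecting          = ⊥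
Valid accepting          = ⊤
Valid (ex A b t)         = close A t ⟶* ⌜ b ⌝
Valid (all A b t b' t')  = (close A t ⟶* ⌜ b ⌝) × (close A t' ⟶* ⌜ b' ⌝)

apps-step : ∀ {t t'} Ns → t ⟶ t' → apps t Ns ⟶ apps t' Ns
apps-step []       s = s
apps-step (u ∷ Ns) s = apps-step Ns (ξappˡ s)

close-βstep : ∀ A N N₁ Ns →
  close A (apps (lam N) (N₁ ∷ Ns)) ⟶ close (N₁ ∷ A) (apps N (map (weaken 1) Ns))
close-βstep A N N₁ Ns =
  subst₂ _⟶_ (sym lhs) (sym rhs) (apps-step (map (close A) Ns) β)
  where
    lhs : close A (apps (lam N) (N₁ ∷ Ns))
          ≡ apps (app (lam (closeUnder A N)) (close A N₁)) (map (close A) Ns)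
    lhs = trans (close-apps A (lam N) (N₁ ∷ Ns))
                (cong (λ h → apps (app h (close A N₁)) (map (close A) Ns)) (close-head A (lam N)))
    rhs : close (N₁ ∷ A) (apps N (map (weaken 1) Ns))
          ≡ apps ((closeUnder A N) [ close A N₁ ]) (map (close A) Ns)
    rhs = trans (close-apps (N₁ ∷ A) N (map (weaken 1) Ns))
                (cong₂ apps (close-β A N N₁) (close-weaken A N₁ Ns))

close-ite : ∀ A M₀ M₁ M₂ Ns → close A (apps (ite M₀ M₁ M₂) Ns)
  ≡ apps (ite (close A M₀) (close A M₁) (close A M₂)) (map (close A) Ns)
close-ite A M₀ M₁ M₂ Ns =
  trans (close-apps A _ Ns) (cong (λ h → apps h (map (close A) Ns)) (close-head A (ite M₀ M₁ M₂)))

apps-ite-T : ∀ {s₀ s₁ s₂} Ss → s₀ ⟶* T → apps (ite s₀ s₁ s₂) Ss ⟶* apps s₁ Ss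
apps-ite-T {s₁ = s₁} {s₂} Ss r =
  gmap (λ c → apps (ite c s₁ s₂) Ss) (λ s → apps-step Ss (ξite₀ s)) r ◅◅ apps-step Ss δT ◅ ε

apps-ite-F : ∀ {s₀ s₁ s₂} Ss → s₀ ⟶* F → apps (ite s₀ s₁ s₂) Ss ⟶* apps s₂ Ss
apps-ite-F {s₁ = s₁} {s₂} Ss r =
  gmap (λ c → apps (ite c s₁ s₂) Ss) (λ s → apps-step Ss (ξite₀ s)) r ◅◅ apps-step Ss δF ◅ ε

close-ite-T : ∀ A M₀ M₁ M₂ Ns → close A M₀ ⟶* T →
  close A (apps (ite M₀ M₁ M₂) Ns) ⟶* close A (apps M₁ Ns)
close-ite-T A M₀ M₁ M₂ Ns r =
  subst₂ _⟶*_ (sym (close-ite A M₀ M₁ M₂ Ns)) (sym (close-apps A M₁ Ns))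
    (apps-ite-T {s₂ = close A M₂} (map (close A) Ns) r)

close-ite-F : ∀ A M₀ M₁ M₂ Ns → close A M₀ ⟶* F →
  close A (apps (ite M₀ M₁ M₂) Ns) ⟶* close A (apps M₂ Ns)
close-ite-F A M₀ M₁ M₂ Ns r =
  subst₂ _⟶*_ (sym (close-ite A M₀ M₁ M₂ Ns)) (sym (close-apps A M₂ Ns))
    (apps-ite-F {s₁ = close A M₁} (map (close A) Ns) r)

step-sound : ∀ {A b t c'} → ex A b t ↦ c' → Valid c' → Valid (ex A b t)
step-sound {A} (βstep {N = N} {N₁} {Ns}) v = close-βstep A N N₁ Ns ◅ v
step-sound {A} (hstep {i = i} {N} {Ns} e) v =
  subst (_⟶* _) (sym (close-lookup-apps)) v
  where
    close-lookup-apps : close A (apps (var i) Ns) ≡ close A (apps (weaken (suc i) N) Ns)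
    close-lookup-apps = begin
      close A (apps (var i) Ns)                          ≡⟨ close-apps A (var i) Ns ⟩
      apps (close A (var i)) (map (close A) Ns)          ≡⟨ cong (λ h → apps h (map (close A) Ns))
                                                                  (close-lookup A i e) ⟩
      apps (close A (weaken (suc i) N)) (map (close A) Ns) ≡⟨ sym (close-apps A _ Ns) ⟩
      close A (apps (weaken (suc i) N) Ns)               ∎
      where open ≡-Reasoning
step-sound {A} (if-yes {M₀ = M₀} {M₁} {M₂} {Ns}) (v₀ , v₁) = close-ite-T A M₀ M₁ M₂ Ns v₀ ◅◅ v₁
step-sound {A} (if-no {M₀ = M₀} {M₁} {M₂} {Ns}) (v₀ , v₁)  = close-ite-F A M₀ M₁ M₂ Ns v₀ ◅◅ v₁
step-sound {A} acc-yes _ = subst (_⟶* T) (sym (close-head A T)) ε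
step-sound {A} acc-no  _ = subst (_⟶* F) (sym (close-head A F)) ε
step-sound rej-yes ()
step-sound rej-no  ()

accepts-sound : ∀ {c} → Accepts c → Valid c
accepts-sound accept      = tt
accepts-sound (acc-∃ s a) = step-sound s (accepts-sound a)
accepts-sound (acc-∀ f)   = accepts-sound (f if′ˡ) , accepts-sound (f if′ʳ)

-- Completeness of the machine

NotVar : Term → Set
NotVar (var _) = ⊥
NotVar _       = ⊤

-- Following h-transitions, the head t of a configuration either turns into a
-- non-variable term with the same closure (and acceptance transfers back along
-- the h-transitions), or its closure is a free variable.
data Resolution (A : MCtx) (t : Term) : Set where
  free  : (j : ℕ) → close A t ≡ var j → Resolution A t
  found : (t' : Term) → NotVar t' → close A t ≡ close A t' →
          (∀ b Ns → Accepts (ex A b (apps t' Ns)) → Accepts (ex A b (apps t Ns))) →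
          Resolution A t

here : ∀ {A} t → NotVar t → Resolution A t
here t nv = found t nv refl (λ _ _ a → a)

resolution-lookup : ∀ {A i N} → lookupCtx A i ≡ just N →
  Resolution A (weaken (suc i) N) → Resolution A (var i)
resolution-lookup {A} {i} e (free j e')         = free j (trans (close-lookup A i e) e')
resolution-lookup {A} {i} e (found t nv e' acc) =
  found t nv (trans (close-lookup A i e) e') (λ b Ns a → acc-∃ (hstep {Ns = Ns} e) (acc b Ns a))

fuel-step : ∀ n i j k → n ≤ i + suc k → n ≤ (j + suc i) + k
fuel-step n i j k h =
  ≤-trans h (≤-trans (≤-reflexive (+-suc i k)) (+-monoˡ-≤ k (m≤n+m (suc i) j)))

-- resolving variable i; the fuel k bounds the number of h-transitions, since
-- every entry only refers to entries older than itself
resolve-var : ∀ k A i → length A ≤ i + k → Resolution A (var i)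
resolve-var k A i h with lookupCtx A i in e
... | nothing with close-free A i e
...   | j , e' = free j e'
resolve-var zero A i h | just N =
  ⊥-elim (<⇒≱ (lookup-< A i e) (subst (length A ≤_) (+-identityʳ i) h))
resolve-var (suc k) A i h | just (var j) =
  resolution-lookup e (resolve-var k A (j + suc i) (fuel-step (length A) i j k h))
resolve-var (suc k) A i h | just F              = resolution-lookup e (here F tt)
resolve-var (suc k) A i h | just T              = resolution-lookup e (here T tt)
resolve-var (suc k) A i h | just (lam N)        = resolution-lookup e (here (lam _) tt)
resolve-var (suc k) A i h | just (app N N')     = resolution-lookup e (here (app _ _) tt)
resolve-var (suc k) A i h | just (ite N N' N'') = resolution-lookup e (here (ite _ _ _) tt)

resolve : ∀ A t → Resolution A t
resolve A (var i)     = resolve-var (length A) A i (m≤n+m (length A) i)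
resolve A F           = here F tt
resolve A T           = here T tt
resolve A (lam N)     = here (lam N) tt
resolve A (app t u)   = here (app t u) tt
resolve A (ite t u v) = here (ite t u v) tt

-- completeness, by induction on the evaluation of the closed configuration; the
-- closed term and stack are related by equations so that Ev can be inverted
complete : ∀ {s Ss b} → Ev s Ss b → ∀ A t Ns →
  close A t ≡ s → map (close A) Ns ≡ Ss → Accepts (ex A b (apps t Ns))

complete-head : ∀ {s Ss b} → Ev s Ss b → ∀ A t → NotVar t → ∀ Ns →
  closeHead A t ≡ s → map (close A) Ns ≡ Ss → Accepts (ex A b (apps t Ns))

complete d A t Ns e₁ e₂ with resolve A t
... | free j e = ⊥-elim (no-var (subst (λ s → Ev s _ _) (trans (sym e₁) e) d))
  where no-var : ∀ {j Ss b} → Ev (var j) Ss b → ⊥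
        no-var ()
... | found t' nv e acc =
  acc _ Ns (complete-head d A t' nv Ns (trans (sym (close-head A t')) (trans (sym e) e₁)) e₂)

complete-head ev-F A F _ [] refl refl = acc-∃ acc-no accept
complete-head ev-T A T _ [] refl refl = acc-∃ acc-yes accept
complete-head (ev-β d) A (lam N) _ (N₁ ∷ Ns) refl refl =
  acc-∃ (βstep {N = N} {N₁} {Ns})
        (complete d (N₁ ∷ A) N (map (weaken 1) Ns) (close-β A N N₁) (close-weaken A N₁ Ns))
complete-head (ev-app d) A (app t u) _ Ns refl refl = complete d A t (u ∷ Ns) refl refl
complete-head (ev-iT d₀ d₁) A (ite M₀ M₁ M₂) _ Ns refl refl =
  acc-∃ (if-yes {M₀ = M₀} {M₁} {M₂} {Ns}) (acc-∀ λ
    { if′ˡ → complete d₀ A M₀ [] refl refl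
    ; if′ʳ → complete d₁ A M₁ Ns refl refl })
complete-head (ev-iF d₀ d₁) A (ite M₀ M₁ M₂) _ Ns refl refl =
  acc-∃ (if-no {M₀ = M₀} {M₁} {M₂} {Ns}) (acc-∀ λ
    { if′ˡ → complete d₀ A M₀ [] refl refl
    ; if′ʳ → complete d₁ A M₂ Ns refl refl })

accepts-complete : ∀ A b t → close A t ⟶* ⌜ b ⌝ → Accepts (ex A b t)
accepts-complete A b t r =
  complete (head*→ev b (standardization b r)) A t [] refl refl

accepts-ex : ∀ A b t → Accepts (ex A b t) ⇔ (b ← close A t)
accepts-ex A b t = mk⇔ (λ a → reduces-← (accepts-sound a))
                       (λ h → accepts-complete A b t (←-reduces h))

accepts-all : ∀ A b t b' t' →
  Accepts (all A b t b' t') ⇔ ((b ← close A t) × (b' ← close A t'))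
accepts-all A b t b' t' = mk⇔
  (λ a → let (v , v') = accepts-sound {all A b t b' t'} a in reduces-← v , reduces-← v')
  (λ { (h , h') → acc-∀ λ
       { if′ˡ → accepts-complete A b t (←-reduces h)
       ; if′ʳ → accepts-complete A b' t' (←-reduces h') } })

lemma15 : ∀ (M : Term) → Program M → ∀ (c : Config) → Reachable M c →
    (∀ A b t → c ≡ ex A b t → (Accepts c ⇔ (b ← close A t))) ×
    (∀ A b t b' t' → c ≡ all A b t b' t' →
      (Accepts c ⇔ ((b ← close A t) × (b' ← close A t'))))
lemma15 M _ c _ = (λ { A b t refl → accepts-ex A b t })
                , (λ { A b t b' t' refl → accepts-all A b t b' t' })
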